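{- Let $G$ and $H$ be graphs ($H$ with at least one vertex) and let $\mathcal{C}=\{C_1,\dots,C_q\}$ be a clique cover of $G$. Then \[D_i(G^{\Delta}(H),x)=\big(D_i(H,x)\big)^{q}\, I\Big(G,\frac{x}{D_i(H,x)}\Big).\]
   Context: All graphs are finite and simple. A set $S\subseteq V(G)$ is an independent dominating set of $G$ if no two vertices of $S$ are adjacent and every vertex of $V(G)\setminus S$ has a neighbour in $S$. $d_i(G,k)$ is the number of independent dominating sets of $G$ of size $k$ and $D_i(G,x)=\sum_k d_i(G,k)x^k$. The independence polynomial is $I(G,x)=\sum_{k\ge 0} i(G,k)x^k$, where $i(G,k)$ is the number of independent sets of size $k$ in $G$ (so $i(G,0)=1$). A clique cover of $G$ is a partition of $V(G)$ into cliques $C_1,\dots,C_q$. The compound graph $G^{\Delta}(H)$ (with respect to $\mathcal{C}$) is obtained from $G$ by adding, for each clique $C_j$, a new disjoint copy $H_j$ of $H$ and joining every vertex of $C_j$ to every vertex of $H_j$. -}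

module Defs where

open import Data.Nat as ℕ using (ℕ; zero; suc)
open import Data.Fin as Fin using (Fin; splitAt; quotRem)
open import Data.Fin.Properties using (all?; any?) renaming (_≟_ to _≟ᶠ_)
open import Data.Fin.Subset using (Subset; _∈_; _∉_; ∣_∣)
open import Data.Fin.Subset.Properties using (_∈?_)
open import Data.Vec using ([]; _∷_)
open import Data.Bool using (true; false)
open import Data.List using (List; []; _∷_; _++_; map; filter; length)
open import Data.Product using (_×_; _,_; ∃; proj₁; proj₂)
open import Data.Sum using (inj₁; inj₂)
open import Data.Integer using (+_)
open import Data.Rational using (ℚ; _/_; 0ℚ; 1ℚ; _+_; _*_)
open import Relation.Nullary using (¬_; Dec; yes; no)
open import Relation.Nullary.Decidable using (¬?; _×-dec_; _→-dec_)
open import Relation.Binary using (Decidable)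
open import Relation.Binary.PropositionalEquality using (_≡_; _≢_; refl) renaming (sym to ≡-sym)

record Graph (n : ℕ) : Set₁ where
  field
    Adj    : Fin n → Fin n → Set
    adj?   : Decidable Adj
    sym    : ∀ {u v} → Adj u v → Adj v u
    irrefl : ∀ {u} → ¬ Adj u u
open Graph public

Independent : ∀ {n} → Graph n → Subset n → Set
Independent G S = ∀ u v → u ∈ S → v ∈ S → ¬ Adj G u v

Dominating : ∀ {n} → Graph n → Subset n → Set
Dominating G S = ∀ v → v ∉ S → ∃ λ u → u ∈ S × Adj G u v

IndepDominating : ∀ {n} → Graph n → Subset n → Set
IndepDominating G S = Independent G S × Dominating G S

independent? : ∀ {n} (G : Graph n) (S : Subset n) → Dec (Independent G S)
independent? G S =
  all? λ u → all? λ v → (u ∈? S) →-dec ((v ∈? S) →-dec ¬? (adj? G u v))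

dominating? : ∀ {n} (G : Graph n) (S : Subset n) → Dec (Dominating G S)
dominating? G S =
  all? λ v → ¬? (v ∈? S) →-dec any? (λ u → (u ∈? S) ×-dec adj? G u v)

indepDominating? : ∀ {n} (G : Graph n) (S : Subset n) → Dec (IndepDominating G S)
indepDominating? G S = independent? G S ×-dec dominating? G S

allSubsets : ∀ n → List (Subset n)
allSubsets zero = [] ∷ []
allSubsets (suc n) = map (true ∷_) (allSubsets n) ++ map (false ∷_) (allSubsets n)

iCount : ∀ {n} → Graph n → ℕ → ℕ
iCount {n} G k =
  length (filter (λ S → (∣ S ∣ ℕ.≟ k) ×-dec independent? G S) (allSubsets n))

diCount : ∀ {n} → Graph n → ℕ → ℕ
diCount {n} G k =
  length (filter (λ S → (∣ S ∣ ℕ.≟ k) ×-dec indepDominating? G S) (allSubsets n))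

fromℕ : ℕ → ℚ
fromℕ k = + k / 1

infixr 8 _^_
_^_ : ℚ → ℕ → ℚ
x ^ zero = 1ℚ
x ^ suc k = x * (x ^ k)

sumTo : ℕ → (ℕ → ℚ) → ℚ
sumTo zero f = f 0
sumTo (suc N) f = sumTo N f + f (suc N)

-- I(G,x) = Σ_k i(G,k) x^k   (i(G,k) = 0 for k > n)
IPoly : ∀ {n} → Graph n → ℚ → ℚ
IPoly {n} G x = sumTo n λ k → fromℕ (iCount G k) * x ^ k

-- D_i(G,x) = Σ_k d_i(G,k) x^k   (d_i(G,k) = 0 for k > n)
DiPoly : ∀ {n} → Graph n → ℚ → ℚ
DiPoly {n} G x = sumTo n λ k → fromℕ (diCount G k) * x ^ k

-- Clique covers: a partition of V(G) into q nonempty cliques C_0..C_{q-1};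
-- vertex u lies in clique C_(cls u).

record CliqueCover {n} (G : Graph n) (q : ℕ) : Set where
  field
    cls      : Fin n → Fin q
    clique   : ∀ u v → u ≢ v → cls u ≡ cls v → Adj G u v
    nonempty : ∀ j → ∃ λ u → cls u ≡ j
open CliqueCover public

-- Compound graph G^Δ(H) on Fin (n + q * m):
-- the first n vertices are those of G; a vertex j of Fin (q * m) with
-- quotRem m j = (h , c) is vertex h of the copy H_c attached to clique C_c.

module _ {n m q} (G : Graph n) (H : Graph m) (𝒞 : CliqueCover G q) where

  data CV : Set where
    gv : Fin n → CV
    hv : Fin q → Fin m → CV

  view : Fin (n ℕ.+ q ℕ.* m) → CV
  view i with splitAt n i
  ... | inj₁ u = gv u
  ... | inj₂ j = hv (proj₂ (quotRem {q} m j)) (proj₁ (quotRem {q} m j))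

  CAdj : CV → CV → Set
  CAdj (gv u)   (gv v)    = Adj G u v
  CAdj (gv u)   (hv c h)  = cls 𝒞 u ≡ c
  CAdj (hv c h) (gv u)    = cls 𝒞 u ≡ c
  CAdj (hv c h) (hv c' h') = c ≡ c' × Adj H h h'

  cadj? : ∀ a b → Dec (CAdj a b)
  cadj? (gv u)   (gv v)     = adj? G u v
  cadj? (gv u)   (hv c h)   = cls 𝒞 u ≟ᶠ c
  cadj? (hv c h) (gv u)     = cls 𝒞 u ≟ᶠ c
  cadj? (hv c h) (hv c' h') = (c ≟ᶠ c') ×-dec adj? H h h'

  csym : ∀ {a b} → CAdj a b → CAdj b a
  csym {gv u}   {gv v}     p       = sym G p
  csym {gv u}   {hv c h}   p       = p
  csym {hv c h} {gv u}     p       = p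
  csym {hv c h} {hv c' h'} (e , p) = ≡-sym e , sym H p

  cirrefl : ∀ {a} → ¬ CAdj a a
  cirrefl {gv u}   p       = irrefl G p
  cirrefl {hv c h} (_ , p) = irrefl H p

  compound : Graph (n ℕ.+ q ℕ.* m)
  compound = record
    { Adj    = λ i j → CAdj (view i) (view j)
    ; adj?   = λ i j → cadj? (view i) (view j)
    ; sym    = λ {i} {j} → csym {view i} {view j}
    ; irrefl = λ {i} → cirrefl {view i}
    }

module Submission where

-- Both polynomials are weighted subset sums  Σ_S [S has the property] x^|S|.
-- A subset of V(G^Δ(H)) is a tuple (A, B_1 … B_q), A ⊆ V(G), B_c ⊆ V(H_c); it
-- is independent dominating iff A is independent in G and, for each clique
-- C_c, either A meets C_c and B_c = ∅, or A misses C_c and B_c is independent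
-- dominating in H (the converse needs V(H) ≠ ∅).  For fixed A the sum over the
-- B_c is then a product over the cliques of 1 (met) or D = D_i(H, x) (missed);
-- an independent A meets exactly |A| cliques, so with x = y·D its total weight
-- is x^|A| D^(q-|A|) = D^q y^|A|, and summing over A gives D^q · I(G, y).

open import Defs
open import Algebra.Bundles using (CommutativeMonoid)
import Algebra.Properties.CommutativeSemigroup as CommutativeSemigroupProperties
open import Data.Nat as ℕ using (ℕ; zero; suc; _<_; _≤_; z≤n; s≤s)
import Data.Nat.Properties as ℕP
import Data.Nat.Coprimality as Coprimality
import Data.Integer as ℤ
import Data.Integer.Properties as ℤP
open import Data.Rational using (ℚ; NonZero; _*_; _÷_; _+_; _/_; mkℚ; 0ℚ; 1ℚ; 1/_)
open import Data.Rational.Properties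
  using ( normalize-coprime; *-assoc; *-comm; *-identityˡ; *-identityʳ; *-zeroˡ
        ; +-identityˡ; +-identityʳ; +-assoc; *-distribˡ-+; *-distribʳ-+; *-inverseˡ
        ; *-1-commutativeMonoid; +-0-commutativeMonoid )
open import Data.Fin as Fin using (Fin; zero; suc; punchIn; splitAt; quotRem; remQuot; combine; _↑ˡ_; _↑ʳ_)
open import Data.Fin.Properties
  using (all?; any?; ∀-cons; suc-injective; punchInᵢ≢i; splitAt-↑ˡ; splitAt-↑ʳ; combine-remQuot; remQuot-combine)
open import Data.Fin.Subset using (Subset; _∈_; ∣_∣; ⊥; Empty; Nonempty)
open import Data.Fin.Subset.Properties using (∣p∣≤n; _∈?_; nonempty?; drop-∷-Empty; ∣⊥∣≡0)
open import Data.Vec using (Vec; []; _∷_; _++_; concat; lookup; here; there)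
open import Data.Vec.Properties using (lookup-splitAt; lookup-concat; []=⇒lookup; lookup⇒[]=)
open import Data.Vec.Functional using (removeAt)
open import Data.Bool using (Bool; true; false)
open import Data.List as List using (List; filter; length)
open import Data.Product using (_×_; _,_; ∃; proj₁; proj₂; uncurry; swap)
open import Data.Sum using (_⊎_; inj₁; inj₂; [_,_]′)
open import Function using (_∘_)
open import Relation.Nullary using (¬_; Dec; yes; no; contradiction)
open import Relation.Nullary.Decidable using (_×-dec_; _⊎-dec_; ¬?)
import Relation.Binary.PropositionalEquality as ≡
open ≡ using (_≡_; _≢_; refl; cong; cong₂; trans)
open ≡.≡-Reasoning
open CommutativeSemigroupProperties (CommutativeMonoid.commutativeSemigroup *-1-commutativeMonoid)
  using () renaming (interchange to *-interchange; x∙yz≈y∙xz to *-left-comm)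
open CommutativeSemigroupProperties (CommutativeMonoid.commutativeSemigroup +-0-commutativeMonoid)
  using () renaming (interchange to +-interchange)
open import Algebra.Properties.CommutativeMonoid.Sum *-1-commutativeMonoid
  using () renaming (sum to ∏; sum-cong-≗ to ∏-cong; ∑-distrib-+ to ∏-distrib-*; sum-remove to ∏-remove)

fromℕ-suc : ∀ k → fromℕ (suc k) ≡ 1ℚ + fromℕ k
fromℕ-suc k = begin
  fromℕ (suc k)                        ≡⟨ cong (λ z → (ℤ.+ 1 ℤ.+ z) / 1) (≡.sym (ℤP.*-identityʳ (ℤ.+ k))) ⟩
  1ℚ + mkℚ (ℤ.+ k) 0 k/1-coprime      ≡⟨ cong (1ℚ +_) (≡.sym (normalize-coprime k/1-coprime)) ⟩
  1ℚ + fromℕ k                         ∎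
  where
  k/1-coprime : Coprimality.Coprime k 1
  k/1-coprime = Coprimality.sym (Coprimality.1-coprimeTo k)

^-+ : ∀ x a b → x ^ (a ℕ.+ b) ≡ x ^ a * x ^ b
^-+ x zero    b = ≡.sym (*-identityˡ _)
^-+ x (suc a) b = trans (cong (x *_) (^-+ x a b)) (≡.sym (*-assoc x _ _))

^-* : ∀ x y k → (x * y) ^ k ≡ x ^ k * y ^ k
^-* x y zero    = refl
^-* x y (suc k) = trans (cong ((x * y) *_) (^-* x y k)) (*-interchange x y _ _)

÷-*-cancel : ∀ x D .{{_ : NonZero D}} → (x ÷ D) * D ≡ x
÷-*-cancel x D = begin
  x * 1/ D * D    ≡⟨ *-assoc x (1/ D) D ⟩
  x * (1/ D * D)  ≡⟨ cong (x *_) (*-inverseˡ D) ⟩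
  x * 1ℚ          ≡⟨ *-identityʳ x ⟩
  x               ∎

choose : ∀ {p} {P : Set p} → Dec P → ℚ → ℚ → ℚ
choose (yes _) a b = a
choose (no _)  a b = b

𝟙 : ∀ {p} {P : Set p} → Dec P → ℚ
𝟙 d = choose d 1ℚ 0ℚ

choose-yes : ∀ {p} {P : Set p} {a b} → P → (d : Dec P) → choose d a b ≡ a
choose-yes p (yes _) = refl
choose-yes p (no ¬p) = contradiction p ¬p

choose-no : ∀ {p} {P : Set p} {a b} → ¬ P → (d : Dec P) → choose d a b ≡ b
choose-no ¬p (yes p) = contradiction p ¬p
choose-no ¬p (no _)  = refl

choose-⇔ : ∀ {p q} {P : Set p} {Q : Set q} {a b} → (P → Q) → (Q → P) →
           (d : Dec P) (e : Dec Q) → choose d a b ≡ choose e a b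
choose-⇔ P→Q Q→P (yes p) e = ≡.sym (choose-yes (P→Q p) e)
choose-⇔ P→Q Q→P (no ¬p) e = ≡.sym (choose-no (λ q → ¬p (Q→P q)) e)

𝟙-yes : ∀ {p} {P : Set p} → P → (d : Dec P) → 𝟙 d ≡ 1ℚ
𝟙-yes = choose-yes

𝟙-no : ∀ {p} {P : Set p} → ¬ P → (d : Dec P) → 𝟙 d ≡ 0ℚ
𝟙-no = choose-no

𝟙-× : ∀ {p q} {P : Set p} {Q : Set q} (d : Dec P) (e : Dec Q) → 𝟙 (d ×-dec e) ≡ 𝟙 d * 𝟙 e
𝟙-× (yes _) (yes _) = refl
𝟙-× (yes _) (no _)  = refl
𝟙-× (no _)  (yes _) = refl
𝟙-× (no _)  (no _)  = refl

𝟙-guard : ∀ {p} {P : Set p} {a b} (d : Dec P) → (P → a ≡ b) → 𝟙 d * a ≡ 𝟙 d * b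
𝟙-guard (yes p) a≡b = cong (1ℚ *_) (a≡b p)
𝟙-guard {a = a} {b} (no _) _ = trans (*-zeroˡ a) (≡.sym (*-zeroˡ b))

listSum : ∀ {a} {A : Set a} → List A → (A → ℚ) → ℚ
listSum List.[]       f = 0ℚ
listSum (a List.∷ as) f = f a + listSum as f

listSum-++ : ∀ {a} {A : Set a} (xs ys : List A) f →
             listSum (xs List.++ ys) f ≡ listSum xs f + listSum ys f
listSum-++ List.[]       ys f = ≡.sym (+-identityˡ (listSum ys f))
listSum-++ (x List.∷ xs) ys f =
  trans (cong (f x +_) (listSum-++ xs ys f)) (≡.sym (+-assoc (f x) (listSum xs f) (listSum ys f)))

listSum-map : ∀ {a b} {A : Set a} {B : Set b} (g : A → B) (xs : List A) f →
              listSum (List.map g xs) f ≡ listSum xs (λ a → f (g a))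
listSum-map g List.[]       f = refl
listSum-map g (x List.∷ xs) f = cong (f (g x) +_) (listSum-map g xs f)

listSum-cong : ∀ {a} {A : Set a} (xs : List A) {f g} → (∀ a → f a ≡ g a) → listSum xs f ≡ listSum xs g
listSum-cong List.[]       f≗g = refl
listSum-cong (x List.∷ xs) f≗g = cong₂ _+_ (f≗g x) (listSum-cong xs f≗g)

listSum-+ : ∀ {a} {A : Set a} (xs : List A) f g →
            listSum xs (λ a → f a + g a) ≡ listSum xs f + listSum xs g
listSum-+ List.[]       f g = ≡.sym (+-identityˡ 0ℚ)
listSum-+ (x List.∷ xs) f g =
  trans (cong (f x + g x +_) (listSum-+ xs f g)) (+-interchange (f x) (g x) (listSum xs f) (listSum xs g))

count-as-sum : ∀ {a p} {A : Set a} {P : A → Set p} (P? : ∀ a → Dec (P a)) (xs : List A) y →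
               fromℕ (length (filter P? xs)) * y ≡ listSum xs (λ a → 𝟙 (P? a) * y)
count-as-sum P? List.[]       y = *-zeroˡ y
count-as-sum P? (x List.∷ xs) y with P? x
... | yes _ = begin
  fromℕ (suc c) * y                        ≡⟨ cong (_* y) (fromℕ-suc c) ⟩
  (1ℚ + fromℕ c) * y                       ≡⟨ *-distribʳ-+ y 1ℚ (fromℕ c) ⟩
  1ℚ * y + fromℕ c * y                     ≡⟨ cong (1ℚ * y +_) (count-as-sum P? xs y) ⟩
  1ℚ * y + listSum xs (λ a → 𝟙 (P? a) * y) ∎
  where c = length (filter P? xs)
... | no _ = begin
  fromℕ (length (filter P? xs)) * y        ≡⟨ count-as-sum P? xs y ⟩
  listSum xs (λ a → 𝟙 (P? a) * y)          ≡⟨ ≡.sym (+-identityˡ _) ⟩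
  0ℚ + listSum xs (λ a → 𝟙 (P? a) * y)     ≡⟨ cong (_+ listSum xs (λ a → 𝟙 (P? a) * y)) (≡.sym (*-zeroˡ y)) ⟩
  0ℚ * y + listSum xs (λ a → 𝟙 (P? a) * y) ∎

sumTo-cong : ∀ N {f g} → (∀ k → f k ≡ g k) → sumTo N f ≡ sumTo N g
sumTo-cong zero    f≗g = f≗g 0
sumTo-cong (suc N) f≗g = cong₂ _+_ (sumTo-cong N f≗g) (f≗g (suc N))

sumTo-listSum : ∀ {a} {A : Set a} (xs : List A) N (g : ℕ → A → ℚ) →
                sumTo N (λ k → listSum xs (g k)) ≡ listSum xs (λ a → sumTo N (λ k → g k a))
sumTo-listSum xs zero    g = refl
sumTo-listSum xs (suc N) g =
  trans (cong (_+ listSum xs (g (suc N))) (sumTo-listSum xs N g)) (≡.sym (listSum-+ xs _ _))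

sumTo-vanish : ∀ N {f} → (∀ k → k ≤ N → f k ≡ 0ℚ) → sumTo N f ≡ 0ℚ
sumTo-vanish zero    f≡0 = f≡0 0 z≤n
sumTo-vanish (suc N) f≡0 =
  trans (cong₂ _+_ (sumTo-vanish N (λ k k≤N → f≡0 k (ℕP.m≤n⇒m≤1+n k≤N))) (f≡0 (suc N) ℕP.≤-refl))
        (+-identityˡ 0ℚ)

sumTo-delta : ∀ {s} N (f : ℕ → ℚ) → s ≤ N → sumTo N (λ k → 𝟙 (s ℕ.≟ k) * f k) ≡ f s
sumTo-delta zero f z≤n = *-identityˡ (f 0)
sumTo-delta {s} (suc N) f s≤1+N with ℕP.m≤n⇒m<n∨m≡n s≤1+N
... | inj₁ (s≤s s≤N) = begin
  sumTo N (λ k → 𝟙 (s ℕ.≟ k) * f k) + 𝟙 (s ℕ.≟ suc N) * f (suc N)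
    ≡⟨ cong₂ _+_ (sumTo-delta N f s≤N) (off-diagonal (suc N) (ℕP.<⇒≢ (s≤s s≤N))) ⟩
  f s + 0ℚ ≡⟨ +-identityʳ (f s) ⟩
  f s      ∎
  where
  off-diagonal : ∀ k → s ≢ k → 𝟙 (s ℕ.≟ k) * f k ≡ 0ℚ
  off-diagonal k s≢k = trans (cong (_* f k) (𝟙-no s≢k (s ℕ.≟ k))) (*-zeroˡ (f k))
... | inj₂ refl = begin
  sumTo N (λ k → 𝟙 (suc N ℕ.≟ k) * f k) + 𝟙 (suc N ℕ.≟ suc N) * f (suc N)
    ≡⟨ cong₂ _+_ (sumTo-vanish N below) (cong (_* f (suc N)) (𝟙-yes refl (suc N ℕ.≟ suc N))) ⟩
  0ℚ + 1ℚ * f (suc N) ≡⟨ +-identityˡ _ ⟩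
  1ℚ * f (suc N)      ≡⟨ *-identityˡ _ ⟩
  f (suc N)           ∎
  where
  below : ∀ k → k ≤ N → 𝟙 (suc N ℕ.≟ k) * f k ≡ 0ℚ
  below k k≤N = trans (cong (_* f k) (𝟙-no (λ { refl → ℕP.1+n≰n k≤N }) (suc N ℕ.≟ k))) (*-zeroˡ (f k))

ΣS : ∀ n → (Subset n → ℚ) → ℚ
ΣS zero    f = f []
ΣS (suc n) f = ΣS n (λ S → f (true ∷ S)) + ΣS n (λ S → f (false ∷ S))

ΣS-cong : ∀ n {f g} → (∀ S → f S ≡ g S) → ΣS n f ≡ ΣS n g
ΣS-cong zero    f≗g = f≗g []
ΣS-cong (suc n) f≗g = cong₂ _+_ (ΣS-cong n (λ S → f≗g (true ∷ S))) (ΣS-cong n (λ S → f≗g (false ∷ S)))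

ΣS-vanish : ∀ n {f} → (∀ S → f S ≡ 0ℚ) → ΣS n f ≡ 0ℚ
ΣS-vanish zero    f≡0 = f≡0 []
ΣS-vanish (suc n) f≡0 =
  trans (cong₂ _+_ (ΣS-vanish n (λ S → f≡0 (true ∷ S))) (ΣS-vanish n (λ S → f≡0 (false ∷ S)))) (+-identityˡ 0ℚ)

ΣS-*ˡ : ∀ n K f → ΣS n (λ S → K * f S) ≡ K * ΣS n f
ΣS-*ˡ zero    K f = refl
ΣS-*ˡ (suc n) K f = trans (cong₂ _+_ (ΣS-*ˡ n K (λ S → f (true ∷ S))) (ΣS-*ˡ n K (λ S → f (false ∷ S))))
                          (≡.sym (*-distribˡ-+ K (ΣS n (λ S → f (true ∷ S))) (ΣS n (λ S → f (false ∷ S)))))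

ΣS-*ʳ : ∀ n f K → ΣS n (λ S → f S * K) ≡ ΣS n f * K
ΣS-*ʳ zero    f K = refl
ΣS-*ʳ (suc n) f K = trans (cong₂ _+_ (ΣS-*ʳ n (λ S → f (true ∷ S)) K) (ΣS-*ʳ n (λ S → f (false ∷ S)) K))
                          (≡.sym (*-distribʳ-+ K (ΣS n (λ S → f (true ∷ S))) (ΣS n (λ S → f (false ∷ S)))))

listSum-allSubsets : ∀ n f → listSum (allSubsets n) f ≡ ΣS n f
listSum-allSubsets zero    f = +-identityʳ (f [])
listSum-allSubsets (suc n) f = begin
  listSum (List.map (true ∷_) (allSubsets n) List.++ List.map (false ∷_) (allSubsets n)) f
    ≡⟨ listSum-++ (List.map (true ∷_) (allSubsets n)) _ f ⟩
  listSum (List.map (true ∷_) (allSubsets n)) f + listSum (List.map (false ∷_) (allSubsets n)) f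
    ≡⟨ cong₂ _+_ (listSum-map (true ∷_) (allSubsets n) f) (listSum-map (false ∷_) (allSubsets n) f) ⟩
  listSum (allSubsets n) (λ S → f (true ∷ S)) + listSum (allSubsets n) (λ S → f (false ∷ S))
    ≡⟨ cong₂ _+_ (listSum-allSubsets n _) (listSum-allSubsets n _) ⟩
  ΣS (suc n) f ∎

ΣS-++ : ∀ a b f → ΣS (a ℕ.+ b) f ≡ ΣS a (λ A → ΣS b (λ B → f (A ++ B)))
ΣS-++ zero    b f = refl
ΣS-++ (suc a) b f = cong₂ _+_ (ΣS-++ a b _) (ΣS-++ a b _)

subset-polynomial : ∀ {p} n {P : Subset n → Set p} (P? : ∀ S → Dec (P S)) x →
  sumTo n (λ k → fromℕ (length (filter (λ S → (∣ S ∣ ℕ.≟ k) ×-dec P? S) (allSubsets n))) * x ^ k)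
  ≡ ΣS n (λ S → 𝟙 (P? S) * x ^ ∣ S ∣)
subset-polynomial n P? x = begin
  sumTo n (λ k → fromℕ (length (filter (λ S → (∣ S ∣ ℕ.≟ k) ×-dec P? S) (allSubsets n))) * x ^ k)
    ≡⟨ sumTo-cong n (λ k → count-as-sum _ (allSubsets n) (x ^ k)) ⟩
  sumTo n (λ k → listSum (allSubsets n) (λ S → 𝟙 ((∣ S ∣ ℕ.≟ k) ×-dec P? S) * x ^ k))
    ≡⟨ sumTo-listSum (allSubsets n) n _ ⟩
  listSum (allSubsets n) (λ S → sumTo n (λ k → 𝟙 ((∣ S ∣ ℕ.≟ k) ×-dec P? S) * x ^ k))
    ≡⟨ listSum-cong (allSubsets n) coefficient ⟩
  listSum (allSubsets n) (λ S → 𝟙 (P? S) * x ^ ∣ S ∣)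
    ≡⟨ listSum-allSubsets n _ ⟩
  ΣS n (λ S → 𝟙 (P? S) * x ^ ∣ S ∣) ∎
  where
  coefficient : ∀ S → sumTo n (λ k → 𝟙 ((∣ S ∣ ℕ.≟ k) ×-dec P? S) * x ^ k) ≡ 𝟙 (P? S) * x ^ ∣ S ∣
  coefficient S = begin
    sumTo n (λ k → 𝟙 ((∣ S ∣ ℕ.≟ k) ×-dec P? S) * x ^ k)
      ≡⟨ sumTo-cong n (λ k → trans (cong (_* x ^ k) (𝟙-× (∣ S ∣ ℕ.≟ k) (P? S))) (*-assoc (𝟙 (∣ S ∣ ℕ.≟ k)) (𝟙 (P? S)) (x ^ k))) ⟩
    sumTo n (λ k → 𝟙 (∣ S ∣ ℕ.≟ k) * (𝟙 (P? S) * x ^ k))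
      ≡⟨ sumTo-delta n (λ k → 𝟙 (P? S) * x ^ k) (∣p∣≤n S) ⟩
    𝟙 (P? S) * x ^ ∣ S ∣ ∎

DiPoly-as-sum : ∀ {n} (G : Graph n) x → DiPoly G x ≡ ΣS n (λ S → 𝟙 (indepDominating? G S) * x ^ ∣ S ∣)
DiPoly-as-sum {n} G = subset-polynomial n (indepDominating? G)

IPoly-as-sum : ∀ {n} (G : Graph n) x → IPoly G x ≡ ΣS n (λ S → 𝟙 (independent? G S) * x ^ ∣ S ∣)
IPoly-as-sum {n} G = subset-polynomial n (independent? G)

∏-const : ∀ q K → ∏ {q} (λ _ → K) ≡ K ^ q
∏-const zero    K = refl
∏-const (suc q) K = cong (K *_) (∏-const q K)

∏-𝟙 : ∀ q {p} {R : Fin q → Set p} (d : ∀ c → Dec (R c)) (D : Dec (∀ c → R c)) →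
      ∏ (λ c → 𝟙 (d c)) ≡ 𝟙 D
∏-𝟙 zero    d D = ≡.sym (𝟙-yes (λ ()) D)
∏-𝟙 (suc q) d D = begin
  𝟙 (d zero) * ∏ (λ c → 𝟙 (d (suc c)))  ≡⟨ cong (𝟙 (d zero) *_) (∏-𝟙 q (d ∘ suc) (all? (d ∘ suc))) ⟩
  𝟙 (d zero) * 𝟙 (all? (d ∘ suc))       ≡⟨ ≡.sym (𝟙-× (d zero) (all? (d ∘ suc))) ⟩
  𝟙 (d zero ×-dec all? (d ∘ suc))        ≡⟨ choose-⇔ (uncurry ∀-cons) (λ r → r zero , r ∘ suc) _ D ⟩
  𝟙 D                                    ∎

∏-exchange : ∀ {q} (g h : Fin q → ℚ) c₀ → (∀ c → c ≢ c₀ → g c ≡ h c) → h c₀ * ∏ g ≡ g c₀ * ∏ h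
∏-exchange {suc q} g h c₀ agree = begin
  h c₀ * ∏ g                          ≡⟨ cong (h c₀ *_) (∏-remove {i = c₀} g) ⟩
  h c₀ * (g c₀ * ∏ (removeAt g c₀))   ≡⟨ *-left-comm (h c₀) (g c₀) _ ⟩
  g c₀ * (h c₀ * ∏ (removeAt g c₀))   ≡⟨ cong (λ z → g c₀ * (h c₀ * z)) (∏-cong (λ j → agree (punchIn c₀ j) (punchInᵢ≢i c₀ j))) ⟩
  g c₀ * (h c₀ * ∏ (removeAt h c₀))   ≡⟨ cong (g c₀ *_) (≡.sym (∏-remove {i = c₀} h)) ⟩
  g c₀ * ∏ h                          ∎

Meets : ∀ {n q} → (Fin n → Fin q) → Subset n → Fin q → Set
Meets f A c = ∃ λ u → u ∈ A × f u ≡ c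

meets? : ∀ {n q} (f : Fin n → Fin q) (A : Subset n) (c : Fin q) → Dec (Meets f A c)
meets? f A c = any? (λ u → (u ∈? A) ×-dec (f u Fin.≟ c))

InjectiveOn : ∀ {n q} → (Fin n → Fin q) → Subset n → Set
InjectiveOn f A = ∀ u v → u ∈ A → v ∈ A → f u ≡ f v → u ≡ v

module MeetsTail {n q} (f : Fin (suc n) → Fin q) (A : Subset n) where

  drop-meets : ∀ {b c} → (b ≡ true → f zero ≢ c) → Meets f (b ∷ A) c → Meets (f ∘ suc) A c
  drop-meets first (zero , here , e)          = contradiction e (first refl)
  drop-meets first (suc u , there u∈A , e)    = u , u∈A , e

  add-meets : ∀ {b c} → Meets (f ∘ suc) A c → Meets f (b ∷ A) c
  add-meets (u , u∈A , e) = suc u , there u∈A , e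

  tail-injective : ∀ {b} → InjectiveOn f (b ∷ A) → InjectiveOn (f ∘ suc) A
  tail-injective inj u v u∈A v∈A e = suc-injective (inj (suc u) (suc v) (there u∈A) (there v∈A) e)

-- If f is injective on A then A meets exactly |A| fibres, so the product of
-- "1 on met fibres, D on missed fibres" is D^(q - |A|).
∏-missed : ∀ n q (f : Fin n → Fin q) (A : Subset n) D → InjectiveOn f A →
           ∏ (λ c → choose (meets? f A c) 1ℚ D) * D ^ ∣ A ∣ ≡ D ^ q
∏-missed zero q f [] D _ = begin
  ∏ (λ c → choose (meets? f [] c) 1ℚ D) * 1ℚ ≡⟨ *-identityʳ _ ⟩
  ∏ (λ c → choose (meets? f [] c) 1ℚ D)      ≡⟨ ∏-cong (λ c → choose-no {a = 1ℚ} (λ { (() , _) }) (meets? f [] c)) ⟩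
  ∏ {q} (λ _ → D)                            ≡⟨ ∏-const q D ⟩
  D ^ q                                      ∎
∏-missed (suc n) q f (false ∷ A) D inj = begin
  ∏ (λ c → choose (meets? f (false ∷ A) c) 1ℚ D) * D ^ ∣ A ∣
    ≡⟨ cong (_* D ^ ∣ A ∣) (∏-cong (λ c → choose-⇔ (drop-meets (λ ())) add-meets (meets? f (false ∷ A) c) (meets? (f ∘ suc) A c))) ⟩
  ∏ (λ c → choose (meets? (f ∘ suc) A c) 1ℚ D) * D ^ ∣ A ∣
    ≡⟨ ∏-missed n q (f ∘ suc) A D (tail-injective inj) ⟩
  D ^ q ∎
  where open MeetsTail f A
∏-missed (suc n) q f (true ∷ A) D inj = begin
  ∏ met * (D * D ^ ∣ A ∣)       ≡⟨ ≡.sym (*-assoc (∏ met) D (D ^ ∣ A ∣)) ⟩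
  ∏ met * D * D ^ ∣ A ∣         ≡⟨ cong (_* D ^ ∣ A ∣) (*-comm (∏ met) D) ⟩
  D * ∏ met * D ^ ∣ A ∣         ≡⟨ cong (_* D ^ ∣ A ∣) exchange ⟩
  1ℚ * ∏ met′ * D ^ ∣ A ∣       ≡⟨ cong (_* D ^ ∣ A ∣) (*-identityˡ (∏ met′)) ⟩
  ∏ met′ * D ^ ∣ A ∣            ≡⟨ ∏-missed n q (f ∘ suc) A D (tail-injective inj) ⟩
  D ^ q                         ∎
  where
  open MeetsTail f A
  met met′ : Fin q → ℚ
  met  c = choose (meets? f (true ∷ A) c) 1ℚ D
  met′ c = choose (meets? (f ∘ suc) A c) 1ℚ D
  missed-by-tail : ¬ Meets (f ∘ suc) A (f zero)
  missed-by-tail (u , u∈A , e) with inj (suc u) zero (there u∈A) here e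
  ... | ()
  exchange : D * ∏ met ≡ 1ℚ * ∏ met′
  exchange = begin
    D * ∏ met              ≡⟨ cong (_* ∏ met) (≡.sym (choose-no missed-by-tail (meets? (f ∘ suc) A (f zero)))) ⟩
    met′ (f zero) * ∏ met  ≡⟨ ∏-exchange met met′ (f zero) agree ⟩
    met (f zero) * ∏ met′  ≡⟨ cong (_* ∏ met′) (choose-yes (zero , here , refl) (meets? f (true ∷ A) (f zero))) ⟩
    1ℚ * ∏ met′            ∎
    where
    agree : ∀ c → c ≢ f zero → met c ≡ met′ c
    agree c c≢f0 = choose-⇔ (drop-meets (λ { refl e → c≢f0 (≡.sym e) })) add-meets
                     (meets? f (true ∷ A) c) (meets? (f ∘ suc) A c)

ΣV : ∀ m q → (Vec (Subset m) q → ℚ) → ℚ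
ΣV m zero    f = f []
ΣV m (suc q) f = ΣS m (λ B → ΣV m q (λ Bs → f (B ∷ Bs)))

ΣV-cong : ∀ m q {f g} → (∀ Bs → f Bs ≡ g Bs) → ΣV m q f ≡ ΣV m q g
ΣV-cong m zero    f≗g = f≗g []
ΣV-cong m (suc q) f≗g = ΣS-cong m (λ B → ΣV-cong m q (λ Bs → f≗g (B ∷ Bs)))

ΣV-*ˡ : ∀ m q K f → ΣV m q (λ Bs → K * f Bs) ≡ K * ΣV m q f
ΣV-*ˡ m zero    K f = refl
ΣV-*ˡ m (suc q) K f = trans (ΣS-cong m (λ B → ΣV-*ˡ m q K (λ Bs → f (B ∷ Bs)))) (ΣS-*ˡ m K _)

ΣS-concat : ∀ m q f → ΣS (q ℕ.* m) f ≡ ΣV m q (λ Bs → f (concat Bs))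
ΣS-concat m zero    f = refl
ΣS-concat m (suc q) f = trans (ΣS-++ m (q ℕ.* m) f) (ΣS-cong m (λ B → ΣS-concat m q (λ C → f (B ++ C))))

ΣV-∏ : ∀ m q (g : Fin q → Subset m → ℚ) →
       ΣV m q (λ Bs → ∏ (λ c → g c (lookup Bs c))) ≡ ∏ (λ c → ΣS m (g c))
ΣV-∏ m zero    g = refl
ΣV-∏ m (suc q) g = begin
  ΣS m (λ B → ΣV m q (λ Bs → g zero B * ∏ (λ c → g (suc c) (lookup Bs c))))
    ≡⟨ ΣS-cong m (λ B → ΣV-*ˡ m q (g zero B) _) ⟩
  ΣS m (λ B → g zero B * ΣV m q (λ Bs → ∏ (λ c → g (suc c) (lookup Bs c))))
    ≡⟨ ΣS-cong m (λ B → cong (g zero B *_) (ΣV-∏ m q (g ∘ suc))) ⟩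
  ΣS m (λ B → g zero B * ∏ (λ c → ΣS m (g (suc c))))
    ≡⟨ ΣS-*ʳ m (g zero) _ ⟩
  ΣS m (g zero) * ∏ (λ c → ΣS m (g (suc c))) ∎

empty? : ∀ {m} (B : Subset m) → Dec (Empty B)
empty? B = ¬? (nonempty? B)

ΣS-empty : ∀ m (g : Subset m → ℚ) → ΣS m (λ B → 𝟙 (empty? B) * g B) ≡ g ⊥
ΣS-empty zero    g = trans (cong (_* g []) (𝟙-yes (λ { (() , _) }) (empty? []))) (*-identityˡ (g []))
ΣS-empty (suc m) g = begin
  ΣS m (λ B → 𝟙 (empty? (true ∷ B)) * g (true ∷ B)) + ΣS m (λ B → 𝟙 (empty? (false ∷ B)) * g (false ∷ B))
    ≡⟨ cong₂ _+_ (ΣS-vanish m (λ B → trans (cong (_* g (true ∷ B)) (𝟙-no (λ e → e (zero , here)) (empty? (true ∷ B))))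
                                           (*-zeroˡ (g (true ∷ B)))))
                 (ΣS-cong m (λ B → cong (_* g (false ∷ B)) (choose-⇔ drop-∷-Empty add-outside (empty? (false ∷ B)) (empty? B)))) ⟩
  0ℚ + ΣS m (λ B → 𝟙 (empty? B) * g (false ∷ B))
    ≡⟨ +-identityˡ _ ⟩
  ΣS m (λ B → 𝟙 (empty? B) * g (false ∷ B))
    ≡⟨ ΣS-empty m (λ B → g (false ∷ B)) ⟩
  g ⊥ ∎
  where
  add-outside : ∀ {B : Subset m} → Empty B → Empty (false ∷ B)
  add-outside empty (suc u , there u∈B) = empty (u , u∈B)

∣-++ : ∀ {a b} (A : Subset a) (B : Subset b) → ∣ A ++ B ∣ ≡ ∣ A ∣ ℕ.+ ∣ B ∣
∣-++ []          B = refl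
∣-++ (true ∷ A)  B = cong suc (∣-++ A B)
∣-++ (false ∷ A) B = ∣-++ A B

^-∣concat∣ : ∀ x m q (Bs : Vec (Subset m) q) → x ^ ∣ concat Bs ∣ ≡ ∏ (λ c → x ^ ∣ lookup Bs c ∣)
^-∣concat∣ x m zero    []       = refl
^-∣concat∣ x m (suc q) (B ∷ Bs) = begin
  x ^ ∣ B ++ concat Bs ∣             ≡⟨ cong (x ^_) (∣-++ B (concat Bs)) ⟩
  x ^ (∣ B ∣ ℕ.+ ∣ concat Bs ∣)      ≡⟨ ^-+ x ∣ B ∣ ∣ concat Bs ∣ ⟩
  x ^ ∣ B ∣ * x ^ ∣ concat Bs ∣      ≡⟨ cong (x ^ ∣ B ∣ *_) (^-∣concat∣ x m q Bs) ⟩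
  x ^ ∣ B ∣ * ∏ (λ c → x ^ ∣ lookup Bs c ∣) ∎

IsIndepDom : ∀ {V : Set} → (V → V → Set) → (V → Set) → Set
IsIndepDom _~_ X = (∀ a b → X a → X b → ¬ a ~ b) × (∀ a → ¬ X a → ∃ λ b → X b × b ~ a)

module Pullback {N} {V : Set} (G : Graph N) (_~_ : V → V → Set) (f : Fin N → V)
                (surjective : ∀ a → ∃ λ i → f i ≡ a)
                (adj⇒ : ∀ {i j} → Adj G i j → f i ~ f j) (adj⇐ : ∀ {i j} → f i ~ f j → Adj G i j)
                (S : Subset N) (X : V → Set) (∈⇒ : ∀ {i} → i ∈ S → X (f i)) (∈⇐ : ∀ {i} → X (f i) → i ∈ S) where

  to : IndepDominating G S → IsIndepDom _~_ X
  to (independent , dominating) = independent′ , dominating′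
    where
    independent′ : ∀ a b → X a → X b → ¬ a ~ b
    independent′ a b Xa Xb a~b with surjective a | surjective b
    ... | i , refl | j , refl = independent i j (∈⇐ Xa) (∈⇐ Xb) (adj⇐ a~b)
    dominating′ : ∀ a → ¬ X a → ∃ λ b → X b × b ~ a
    dominating′ a ¬Xa with surjective a
    ... | i , refl with dominating i (λ i∈S → ¬Xa (∈⇒ i∈S))
    ...   | j , j∈S , ji = f j , ∈⇒ j∈S , adj⇒ ji

  from : IsIndepDom _~_ X → IndepDominating G S
  from (independent , dominating) = independent′ , dominating′
    where
    independent′ : Independent G S
    independent′ i j i∈S j∈S ij = independent (f i) (f j) (∈⇒ i∈S) (∈⇒ j∈S) (adj⇒ ij)
    dominating′ : Dominating G S
    dominating′ i i∉S with dominating (f i) (λ Xfi → i∉S (∈⇐ Xfi))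
    ... | b , Xb , b~fi with surjective b
    ...   | j , refl = j , ∈⇐ Xb , adj⇐ b~fi

dominating-nonempty : ∀ {m} (H : Graph m) → Fin m → ∀ {B} → Dominating H B → Nonempty B
dominating-nonempty H h₀ {B} dominating with h₀ ∈? B
... | yes h₀∈B = h₀ , h₀∈B
... | no  h₀∉B with dominating h₀ h₀∉B
...   | h , h∈B , _ = h , h∈B

independent-injective : ∀ {n q} (G : Graph n) (𝒞 : CliqueCover G q) {A} → Independent G A → InjectiveOn (cls 𝒞) A
independent-injective G 𝒞 independent u v u∈A v∈A same-clique with u Fin.≟ v
... | yes u≡v = u≡v
... | no  u≢v = contradiction (clique 𝒞 u v u≢v same-clique) (independent u v u∈A v∈A)

module Compound {n m q} (G : Graph n) (H : Graph m) (𝒞 : CliqueCover G q) where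

  -- A vertex subset of G^Δ(H) is written A ++ concat Bs with A ⊆ V(G) and
  -- lookup Bs c ⊆ V(H_c); `In A Bs` is this set on the structured vertices.
  In : Subset n → Vec (Subset m) q → CV G H 𝒞 → Set
  In A Bs (gv u)   = u ∈ A
  In A Bs (hv c h) = h ∈ lookup Bs c

  lookupCV : Subset n → Vec (Subset m) q → CV G H 𝒞 → Bool
  lookupCV A Bs (gv u)   = lookup A u
  lookupCV A Bs (hv c h) = lookup (lookup Bs c) h

  lookup-view : ∀ A Bs i → lookup (A ++ concat Bs) i ≡ lookupCV A Bs (view G H 𝒞 i)
  lookup-view A Bs i with splitAt n i in split
  ... | inj₁ u = trans (lookup-splitAt n A (concat Bs) i) (cong [ lookup A , lookup (concat Bs) ]′ split)
  ... | inj₂ j = begin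
    lookup (A ++ concat Bs) i                               ≡⟨ lookup-splitAt n A (concat Bs) i ⟩
    [ lookup A , lookup (concat Bs) ]′ (splitAt n i)        ≡⟨ cong [ lookup A , lookup (concat Bs) ]′ split ⟩
    lookup (concat Bs) j                                    ≡⟨ cong (lookup (concat Bs)) (≡.sym (combine-remQuot {q} m j)) ⟩
    lookup (concat Bs) (uncurry combine (remQuot {q} m j))  ≡⟨ lookup-concat Bs _ _ ⟩
    lookupCV A Bs (hv (proj₂ (quotRem {q} m j)) (proj₁ (quotRem {q} m j))) ∎

  ∈⇒In : ∀ {A Bs i} → i ∈ A ++ concat Bs → In A Bs (view G H 𝒞 i)
  ∈⇒In {A} {Bs} {i} i∈ = In-from-lookup (view G H 𝒞 i) (trans (≡.sym (lookup-view A Bs i)) ([]=⇒lookup i∈))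
    where
    In-from-lookup : ∀ a → lookupCV A Bs a ≡ true → In A Bs a
    In-from-lookup (gv u)   eq = lookup⇒[]= u A eq
    In-from-lookup (hv c h) eq = lookup⇒[]= h (lookup Bs c) eq

  In⇒∈ : ∀ {A Bs i} → In A Bs (view G H 𝒞 i) → i ∈ A ++ concat Bs
  In⇒∈ {A} {Bs} {i} In-i = lookup⇒[]= i (A ++ concat Bs) (trans (lookup-view A Bs i) (lookup-from-In (view G H 𝒞 i) In-i))
    where
    lookup-from-In : ∀ a → In A Bs a → lookupCV A Bs a ≡ true
    lookup-from-In (gv u)   u∈A = []=⇒lookup u∈A
    lookup-from-In (hv c h) h∈B = []=⇒lookup h∈B

  view-surjective : ∀ a → ∃ λ i → view G H 𝒞 i ≡ a
  view-surjective (gv u) = u ↑ˡ (q ℕ.* m) , view-left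
    where
    view-left : view G H 𝒞 (u ↑ˡ (q ℕ.* m)) ≡ gv u
    view-left with splitAt n (u ↑ˡ (q ℕ.* m)) | splitAt-↑ˡ n u (q ℕ.* m)
    ... | .(inj₁ u) | refl = refl
  view-surjective (hv c h) = n ↑ʳ combine c h , view-right
    where
    quotRem-combine : quotRem {q} m (combine c h) ≡ (h , c)
    quotRem-combine = cong swap (remQuot-combine c h)
    view-right : view G H 𝒞 (n ↑ʳ combine c h) ≡ hv c h
    view-right with splitAt n (n ↑ʳ combine c h) | splitAt-↑ʳ n (q ℕ.* m) (combine c h)
    ... | .(inj₂ (combine c h)) | refl = cong₂ hv (cong proj₂ quotRem-combine) (cong proj₁ quotRem-combine)

  module Structured (A : Subset n) (Bs : Vec (Subset m) q) =
    Pullback (compound G H 𝒞) (CAdj G H 𝒞) (view G H 𝒞) view-surjective (λ ij → ij) (λ ij → ij)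
             (A ++ concat Bs) (In A Bs) ∈⇒In In⇒∈

  CliquePart : Subset n → Fin q → Subset m → Set
  CliquePart A c B = (Meets (cls 𝒞) A c × Empty B) ⊎ (¬ Meets (cls 𝒞) A c × IndepDominating H B)

  cliquePart? : ∀ A c B → Dec (CliquePart A c B)
  cliquePart? A c B =
    (meets? (cls 𝒞) A c ×-dec empty? B) ⊎-dec (¬? (meets? (cls 𝒞) A c) ×-dec indepDominating? H B)

  structure⇒ : ∀ A Bs → IsIndepDom (CAdj G H 𝒞) (In A Bs) →
               Independent G A × (∀ c → CliquePart A c (lookup Bs c))
  structure⇒ A Bs (independent , dominating) = (λ u v → independent (gv u) (gv v)) , part
    where
    part : ∀ c → CliquePart A c (lookup Bs c)
    part c with meets? (cls 𝒞) A c
    ... | yes (u , u∈A , u∈C) = inj₁ ((u , u∈A , u∈C) , λ { (h , h∈B) → independent (gv u) (hv c h) u∈A h∈B u∈C })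
    ... | no misses = inj₂ (misses , (λ h h′ h∈B h′∈B hh′ → independent (hv c h) (hv c h′) h∈B h′∈B (refl , hh′)) , dominatingH)
      where
      -- A vertex of H_c outside B can only be dominated inside H_c, since A misses C_c.
      dominatingH : Dominating H (lookup Bs c)
      dominatingH h h∉B with dominating (hv c h) h∉B
      ... | gv u , u∈A , u∈C          = contradiction (u , u∈A , u∈C) misses
      ... | hv .c h′ , h′∈B , (refl , h′h) = h′ , h′∈B , h′h

  -- The converse needs V(H) ≠ ∅: a vertex of a clique missed by A is then
  -- dominated by the (nonempty) independent dominating set of the attached copy of H.
  structure⇐ : Fin m → ∀ A Bs → Independent G A × (∀ c → CliquePart A c (lookup Bs c)) →
               IsIndepDom (CAdj G H 𝒞) (In A Bs)
  structure⇐ h₀ A Bs (independentA , part) = independent , dominating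
    where
    empty-if-met : ∀ c → Meets (cls 𝒞) A c → Empty (lookup Bs c)
    empty-if-met c meets with part c
    ... | inj₁ (_ , empty)  = empty
    ... | inj₂ (misses , _) = contradiction meets misses
    independent : ∀ a b → In A Bs a → In A Bs b → ¬ CAdj G H 𝒞 a b
    independent (gv u)   (gv v)    u∈A v∈A uv = independentA u v u∈A v∈A uv
    independent (gv u)   (hv c h)  u∈A h∈B u∈C = empty-if-met c (u , u∈A , u∈C) (h , h∈B)
    independent (hv c h) (gv u)    h∈B u∈A u∈C = empty-if-met c (u , u∈A , u∈C) (h , h∈B)
    independent (hv c h) (hv .c h′) h∈B h′∈B (refl , hh′) with part c
    ... | inj₁ (_ , empty)                  = empty (h , h∈B)
    ... | inj₂ (_ , (independentH , _))     = independentH h h′ h∈B h′∈B hh′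
    dominating : ∀ a → ¬ In A Bs a → ∃ λ b → In A Bs b × CAdj G H 𝒞 b a
    dominating (gv u) u∉A with part (cls 𝒞 u)
    ... | inj₁ ((v , v∈A , v∈C) , _) with v Fin.≟ u
    ...   | yes refl = contradiction v∈A u∉A
    ...   | no  v≢u  = gv v , v∈A , clique 𝒞 v u v≢u v∈C
    dominating (gv u) u∉A | inj₂ (_ , (_ , dominatingH)) with dominating-nonempty H h₀ dominatingH
    ...   | h , h∈B = hv (cls 𝒞 u) h , h∈B , refl
    dominating (hv c h) h∉B with part c
    ... | inj₁ ((u , u∈A , u∈C) , _) = gv u , u∈A , u∈C
    ... | inj₂ (_ , (_ , dominatingH)) with dominatingH h h∉B
    ...   | h′ , h′∈B , h′h = hv c h′ , h′∈B , (refl , h′h)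

module Count {n m q} (G : Graph n) (H : Graph m) (𝒞 : CliqueCover G q) (h₀ : Fin m) (x : ℚ) where
  open Compound G H 𝒞

  D : ℚ
  D = DiPoly H x

  weight : Subset (n ℕ.+ q ℕ.* m) → ℚ
  weight S = 𝟙 (indepDominating? (compound G H 𝒞) S) * x ^ ∣ S ∣

  missedFactor : Subset n → ℚ
  missedFactor A = ∏ (λ c → choose (meets? (cls 𝒞) A c) 1ℚ D)

  𝟙-structure : ∀ A Bs → 𝟙 (indepDominating? (compound G H 𝒞) (A ++ concat Bs))
                         ≡ 𝟙 (independent? G A) * ∏ (λ c → 𝟙 (cliquePart? A c (lookup Bs c)))
  𝟙-structure A Bs = begin
    𝟙 (indepDominating? (compound G H 𝒞) (A ++ concat Bs))
      ≡⟨ choose-⇔ (structure⇒ A Bs ∘ to) (from ∘ structure⇐ h₀ A Bs) _ (independent? G A ×-dec all? parts?) ⟩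
    𝟙 (independent? G A ×-dec all? parts?)
      ≡⟨ 𝟙-× (independent? G A) (all? parts?) ⟩
    𝟙 (independent? G A) * 𝟙 (all? parts?)
      ≡⟨ cong (𝟙 (independent? G A) *_) (≡.sym (∏-𝟙 q parts? (all? parts?))) ⟩
    𝟙 (independent? G A) * ∏ (λ c → 𝟙 (parts? c)) ∎
    where
    open Structured A Bs
    parts? : ∀ c → Dec (CliquePart A c (lookup Bs c))
    parts? c = cliquePart? A c (lookup Bs c)

  weight-split : ∀ A Bs → weight (A ++ concat Bs)
                 ≡ (𝟙 (independent? G A) * x ^ ∣ A ∣) * ∏ (λ c → 𝟙 (cliquePart? A c (lookup Bs c)) * x ^ ∣ lookup Bs c ∣)
  weight-split A Bs = begin
    𝟙 (indepDominating? (compound G H 𝒞) (A ++ concat Bs)) * x ^ ∣ A ++ concat Bs ∣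
      ≡⟨ cong₂ _*_ (𝟙-structure A Bs) size ⟩
    (𝟙 (independent? G A) * ∏ parts) * (x ^ ∣ A ∣ * ∏ sizes)
      ≡⟨ *-interchange (𝟙 (independent? G A)) (∏ parts) (x ^ ∣ A ∣) (∏ sizes) ⟩
    (𝟙 (independent? G A) * x ^ ∣ A ∣) * (∏ parts * ∏ sizes)
      ≡⟨ cong (𝟙 (independent? G A) * x ^ ∣ A ∣ *_) (≡.sym (∏-distrib-* parts sizes)) ⟩
    (𝟙 (independent? G A) * x ^ ∣ A ∣) * ∏ (λ c → parts c * sizes c) ∎
    where
    parts sizes : Fin q → ℚ
    parts c = 𝟙 (cliquePart? A c (lookup Bs c))
    sizes c = x ^ ∣ lookup Bs c ∣
    size : x ^ ∣ A ++ concat Bs ∣ ≡ x ^ ∣ A ∣ * ∏ sizes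
    size = trans (cong (x ^_) (∣-++ A (concat Bs)))
                 (trans (^-+ x ∣ A ∣ ∣ concat Bs ∣) (cong (x ^ ∣ A ∣ *_) (^-∣concat∣ x m q Bs)))

  clique-sum : ∀ A c → ΣS m (λ B → 𝟙 (cliquePart? A c B) * x ^ ∣ B ∣) ≡ choose (meets? (cls 𝒞) A c) 1ℚ D
  clique-sum A c = by-cases (meets? (cls 𝒞) A c)
    where
    -- Case on a decision that does not occur inside cliquePart?.
    by-cases : (d : Dec (Meets (cls 𝒞) A c)) → ΣS m (λ B → 𝟙 (cliquePart? A c B) * x ^ ∣ B ∣) ≡ choose d 1ℚ D
    by-cases (yes meets) = begin
      ΣS m (λ B → 𝟙 (cliquePart? A c B) * x ^ ∣ B ∣)
        ≡⟨ ΣS-cong m (λ B → cong (_* x ^ ∣ B ∣) (choose-⇔ only-empty (λ e → inj₁ (meets , e)) (cliquePart? A c B) (empty? B))) ⟩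
      ΣS m (λ B → 𝟙 (empty? B) * x ^ ∣ B ∣)
        ≡⟨ ΣS-empty m (λ B → x ^ ∣ B ∣) ⟩
      x ^ ∣ ⊥ {m} ∣
        ≡⟨ cong (x ^_) (∣⊥∣≡0 m) ⟩
      1ℚ ∎
      where
      only-empty : ∀ {B} → CliquePart A c B → Empty B
      only-empty (inj₁ (_ , empty))  = empty
      only-empty (inj₂ (misses , _)) = contradiction meets misses
    by-cases (no misses) = begin
      ΣS m (λ B → 𝟙 (cliquePart? A c B) * x ^ ∣ B ∣)
        ≡⟨ ΣS-cong m (λ B → cong (_* x ^ ∣ B ∣) (choose-⇔ only-indepDom (λ d → inj₂ (misses , d)) (cliquePart? A c B) (indepDominating? H B))) ⟩
      ΣS m (λ B → 𝟙 (indepDominating? H B) * x ^ ∣ B ∣)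
        ≡⟨ ≡.sym (DiPoly-as-sum H x) ⟩
      D ∎
      where
      only-indepDom : ∀ {B} → CliquePart A c B → IndepDominating H B
      only-indepDom (inj₁ (meets , _)) = contradiction meets misses
      only-indepDom (inj₂ (_ , d))     = d

  fibre-sum : ∀ A → ΣV m q (λ Bs → weight (A ++ concat Bs)) ≡ (𝟙 (independent? G A) * x ^ ∣ A ∣) * missedFactor A
  fibre-sum A = begin
    ΣV m q (λ Bs → weight (A ++ concat Bs))
      ≡⟨ ΣV-cong m q (weight-split A) ⟩
    ΣV m q (λ Bs → w * ∏ (λ c → part c (lookup Bs c)))
      ≡⟨ ΣV-*ˡ m q w _ ⟩
    w * ΣV m q (λ Bs → ∏ (λ c → part c (lookup Bs c)))
      ≡⟨ cong (w *_) (ΣV-∏ m q part) ⟩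
    w * ∏ (λ c → ΣS m (part c))
      ≡⟨ cong (w *_) (∏-cong (clique-sum A)) ⟩
    w * missedFactor A ∎
    where
    w : ℚ
    w = 𝟙 (independent? G A) * x ^ ∣ A ∣
    part : Fin q → Subset m → ℚ
    part c B = 𝟙 (cliquePart? A c B) * x ^ ∣ B ∣

  rescale : ∀ y → x ≡ y * D → ∀ {A} → Independent G A → x ^ ∣ A ∣ * missedFactor A ≡ D ^ q * y ^ ∣ A ∣
  rescale y x≡yD {A} independent = begin
    x ^ ∣ A ∣ * missedFactor A                    ≡⟨ cong (λ z → z ^ ∣ A ∣ * missedFactor A) x≡yD ⟩
    (y * D) ^ ∣ A ∣ * missedFactor A              ≡⟨ cong (_* missedFactor A) (^-* y D ∣ A ∣) ⟩
    y ^ ∣ A ∣ * D ^ ∣ A ∣ * missedFactor A        ≡⟨ *-assoc (y ^ ∣ A ∣) (D ^ ∣ A ∣) (missedFactor A) ⟩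
    y ^ ∣ A ∣ * (D ^ ∣ A ∣ * missedFactor A)      ≡⟨ cong (y ^ ∣ A ∣ *_) (*-comm (D ^ ∣ A ∣) (missedFactor A)) ⟩
    y ^ ∣ A ∣ * (missedFactor A * D ^ ∣ A ∣)      ≡⟨ cong (y ^ ∣ A ∣ *_) (∏-missed n q (cls 𝒞) A D (independent-injective G 𝒞 independent)) ⟩
    y ^ ∣ A ∣ * D ^ q                             ≡⟨ *-comm (y ^ ∣ A ∣) (D ^ q) ⟩
    D ^ q * y ^ ∣ A ∣                             ∎

  contribution : ∀ y → x ≡ y * D → ∀ A →
                 (𝟙 (independent? G A) * x ^ ∣ A ∣) * missedFactor A ≡ D ^ q * (𝟙 (independent? G A) * y ^ ∣ A ∣)
  contribution y x≡yD A = begin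
    (𝟙 (independent? G A) * x ^ ∣ A ∣) * missedFactor A  ≡⟨ *-assoc (𝟙 (independent? G A)) (x ^ ∣ A ∣) (missedFactor A) ⟩
    𝟙 (independent? G A) * (x ^ ∣ A ∣ * missedFactor A)  ≡⟨ 𝟙-guard (independent? G A) (rescale y x≡yD) ⟩
    𝟙 (independent? G A) * (D ^ q * y ^ ∣ A ∣)           ≡⟨ *-left-comm (𝟙 (independent? G A)) (D ^ q) (y ^ ∣ A ∣) ⟩
    D ^ q * (𝟙 (independent? G A) * y ^ ∣ A ∣)           ∎

  DiPoly-compound : ∀ y → x ≡ y * D → DiPoly (compound G H 𝒞) x ≡ D ^ q * IPoly G y
  DiPoly-compound y x≡yD = begin
    DiPoly (compound G H 𝒞) x
      ≡⟨ DiPoly-as-sum (compound G H 𝒞) x ⟩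
    ΣS (n ℕ.+ q ℕ.* m) weight
      ≡⟨ ΣS-++ n (q ℕ.* m) weight ⟩
    ΣS n (λ A → ΣS (q ℕ.* m) (λ C → weight (A ++ C)))
      ≡⟨ ΣS-cong n (λ A → ΣS-concat m q (λ C → weight (A ++ C))) ⟩
    ΣS n (λ A → ΣV m q (λ Bs → weight (A ++ concat Bs)))
      ≡⟨ ΣS-cong n (λ A → trans (fibre-sum A) (contribution y x≡yD A)) ⟩
    ΣS n (λ A → D ^ q * (𝟙 (independent? G A) * y ^ ∣ A ∣))
      ≡⟨ ΣS-*ˡ n (D ^ q) (λ A → 𝟙 (independent? G A) * y ^ ∣ A ∣) ⟩
    D ^ q * ΣS n (λ A → 𝟙 (independent? G A) * y ^ ∣ A ∣)
      ≡⟨ cong (D ^ q *_) (≡.sym (IPoly-as-sum G y)) ⟩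
    D ^ q * IPoly G y ∎

-- Substitute y = x / D_i(H, x); the vertex of H required by the structural
-- description comes from 0 < m.
mainTheorem4 : ∀ {n m q} (G : Graph n) (H : Graph m) → 0 < m →
                 (𝒞 : CliqueCover G q) → (x : ℚ) → .{{_ : NonZero (DiPoly H x)}} →
                 DiPoly (compound G H 𝒞) x ≡ (DiPoly H x) ^ q * IPoly G (x ÷ DiPoly H x)
mainTheorem4 {m = suc _} G H (s≤s z≤n) 𝒞 x =
  Count.DiPoly-compound G H 𝒞 zero x (x ÷ DiPoly H x) (≡.sym (÷-*-cancel x (DiPoly H x)))
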